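{- Fix $k\ge 4$, let $G$ be a graph and let $\mathcal{P}$ be the collection of paths returned by the algorithm Approx1 on $G$. Suppose there are a vertex $u_t$ on a path $P\in\mathcal{P}$ and an extension $e(u_t)$ with $n(e(u_t))\ge k-t-1$. Then: (i) for any vertex $u_j$ of $P$ with $j\ge t+1$, we have $j\le k-2$, and every extension $e(u_j)$ vertex-disjoint from $e(u_t)$ has order $n(e(u_j))\le k-j-2$; (ii) for any index $j$, every extension $e(v_j)$ vertex-disjoint from $e(u_t)$ has order $n(e(v_j))\le k-j-2$.
   Context: The order of a path is its number of vertices. $V(\mathcal{P})$ is the union of the vertex sets of the paths in $\mathcal{P}$. Vertex naming on a path $P$ of order $\ell$: choose an endpoint; $u_j$ is the vertex at distance $j$ from it ($0\le j\le\lceil\ell/2\rceil-1$), $v_j$ the vertex at distance $j$ from the other endpoint ($0\le j\le\lfloor\ell/2\rfloor-1$); either endpoint may be $u_0$. For $v\in V(\mathcal{P})$, an extension $e(v)$ is a path in $G[V\setminus V(\mathcal{P})]$ with an endpoint adjacent to $v$ (the empty path of order 0 is allowed); $n(e(v))$ denotes its order. Operations: (Add) if $G[V\setminus V(\mathcal{P})]$ has a $k$-path, add it. (Rep) if for $P\in\mathcal{P}$ there are $t$ and $e(u_t)$ with $n(e(u_t))\ge t+1$, replace the prefix $u_0$-$\cdots$-$u_{t-1}$ by $e(u_t)$ (symmetrically for $v_t$). (DoubleRep) for $P\in\mathcal{P}$: (i) if there are $t$, $j\ge t+1$ and vertex-disjoint $e(u_t),e(u_j)$ with $n(e(u_t))\ge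 k-t-1$, $n(e(u_j))\ge k-(n(P)-j)$, replace $P$ by $u_0$-$\cdots$-$u_t$-$e(u_t)$ and $e(u_j)$-$u_j$-$\cdots$-$v_0$; (ii) if there are $t,j$ and vertex-disjoint $e(u_t),e(v_j)$ with $n(e(u_t))\ge k-t-1$, $n(e(v_j))\ge k-j-1$, replace $P$ by $u_0$-$\cdots$-$u_t$-$e(u_t)$ and $e(v_j)$-$v_j$-$\cdots$-$v_0$. Algorithm Approx1: start with $\mathcal{P}=\emptyset$; while one of Add, Rep, DoubleRep is applicable, apply it and then break every path of order at least $2k$ into two paths one of which is a $k$-path; return $\mathcal{P}$ when none applies. -}

module Defs where

open import Data.Nat using (ℕ; zero; suc; _+_; _∸_; _*_; _≤_; _<_; ⌊_/2⌋; ⌈_/2⌉)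
open import Data.Fin using (Fin)
open import Data.List using (List; []; _∷_; _++_; length; reverse; take; drop; concat)
open import Data.List.Relation.Unary.All using (All)
open import Data.List.Relation.Unary.Linked using (Linked)
open import Data.List.Relation.Unary.Unique.Propositional using (Unique)
open import Data.List.Membership.Propositional using (_∈_)
open import Data.List.Relation.Binary.Subset.Propositional using ()
open import Data.Product using (Σ; _×_; ∃; ∃-syntax)
open import Data.Sum using (_⊎_)
open import Data.Unit using (⊤)
open import Data.Empty using (⊥)
open import Relation.Nullary using (¬_)
open import Relation.Binary.PropositionalEquality using (_≡_)
open import Relation.Binary.Construct.Closure.ReflexiveTransitive using (Star)

record Graph : Set₁ where
  field
    n       : ℕ
    Adj     : Fin n → Fin n → Set
    sym     : ∀ {x y} → Adj x y → Adj y x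
    irrefl  : ∀ {x} → ¬ Adj x x
open Graph public

Vtx : Graph → Set
Vtx G = Fin (n G)

Coll : Graph → Set
Coll G = List (List (Vtx G))

-- A path given by its vertex sequence: distinct vertices, consecutive ones adjacent.
-- Its order is the length of the list (the empty list is the empty path of order 0).
IsPath : (G : Graph) → List (Vtx G) → Set
IsPath G xs = Unique xs × Linked (Adj G) xs

VP : {G : Graph} → Coll G → List (Vtx G)
VP 𝒫 = concat 𝒫

Disjoint : {A : Set} → List A → List A → Set
Disjoint xs ys = All (λ x → ¬ (x ∈ ys)) xs

-- At xs i x : the i-th entry (0-based) of xs is x
data At {A : Set} : List A → ℕ → A → Set where
  here  : ∀ {x xs} → At (x ∷ xs) 0 x
  there : ∀ {x y xs i} → At xs i y → At (x ∷ xs) (suc i) y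

-- Q is one of the two orientations of P (choice of which endpoint is u₀)
Orient : {A : Set} → List A → List A → Set
Orient P Q = (Q ≡ P) ⊎ (Q ≡ reverse P)

-- In the orientation Q of a path of order ℓ = length Q:
-- x = u_j  (0 ≤ j ≤ ⌈ℓ/2⌉-1), the vertex at distance j from Q's first vertex
UVert : {A : Set} → List A → ℕ → A → Set
UVert Q j x = (j < ⌈ length Q /2⌉) × At Q j x

-- x = v_j  (0 ≤ j ≤ ⌊ℓ/2⌋-1), the vertex at distance j from Q's last vertex
VVert : {A : Set} → List A → ℕ → A → Set
VVert Q j x = (j < ⌊ length Q /2⌋) × At Q (length Q ∸ suc j) x

StartAdj : (G : Graph) → Vtx G → List (Vtx G) → Set
StartAdj G v []      = ⊤
StartAdj G v (x ∷ _) = Adj G v x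

-- e is an extension e(v) w.r.t. 𝒫: a path in G[V ∖ V(𝒫)], listed starting at
-- the endpoint adjacent to v (or empty).
Ext : (G : Graph) → Coll G → Vtx G → List (Vtx G) → Set
Ext G 𝒫 v e = IsPath G e × Disjoint e (VP {G} 𝒫) × StartAdj G v e

ReplaceBy : {A : Set} → List (List A) → List A → List (List A) → List (List A) → Set
ReplaceBy {A} 𝒫 P R 𝒫' = Σ (List (List A)) λ L → Σ (List (List A)) λ B → (𝒫 ≡ L ++ (P ∷ B)) × (𝒫' ≡ L ++ (R ++ B))

module _ (G : Graph) (k : ℕ) where

  AddOp : Coll G → Coll G → Set
  AddOp 𝒫 𝒫' = Σ (List (Vtx G)) λ e →
    IsPath G e × length e ≡ k × Disjoint e (VP {G} 𝒫) × (𝒫' ≡ 𝒫 ++ (e ∷ []))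

  RepOp : Coll G → Coll G → Set
  RepOp 𝒫 𝒫' = Σ (List (Vtx G)) λ P → Σ (List (Vtx G)) λ Q → Orient {Vtx G} P Q ×
    Σ ℕ λ t → Σ (Vtx G) λ x → Σ (List (Vtx G)) λ e → Ext G 𝒫 x e × suc t ≤ length e ×
      ( (UVert Q t x × ReplaceBy 𝒫 P ((reverse e ++ drop t Q) ∷ []) 𝒫')
      ⊎ (VVert Q t x × ReplaceBy 𝒫 P ((take (length Q ∸ t) Q ++ e) ∷ []) 𝒫') )

  DoubleRepOp : Coll G → Coll G → Set
  DoubleRepOp 𝒫 𝒫' = Σ (List (Vtx G)) λ P → Σ (List (Vtx G)) λ Q → Orient {Vtx G} P Q ×
    Σ ℕ λ t → Σ (Vtx G) λ x → Σ (List (Vtx G)) λ e → UVert Q t x × Ext G 𝒫 x e ×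
    k ≤ length e + t + 1 ×
    Σ ℕ λ j → Σ (Vtx G) λ y → Σ (List (Vtx G)) λ f → Ext G 𝒫 y f × Disjoint e f ×
      ( (suc t ≤ j × UVert Q j y × k ≤ length f + (length Q ∸ j) ×
           ReplaceBy 𝒫 P ((take (suc t) Q ++ e) ∷ (reverse f ++ drop j Q) ∷ []) 𝒫')
      ⊎ (VVert Q j y × k ≤ length f + j + 1 ×
           ReplaceBy 𝒫 P ((take (suc t) Q ++ e) ∷ (reverse f ++ drop (length Q ∸ suc j) Q) ∷ []) 𝒫') )

  Op : Coll G → Coll G → Set
  Op 𝒫 𝒫' = AddOp 𝒫 𝒫' ⊎ RepOp 𝒫 𝒫' ⊎ DoubleRepOp 𝒫 𝒫'

  Break1 : Coll G → Coll G → Set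
  Break1 𝒫 𝒫' = Σ (List (Vtx G)) λ P → 2 * k ≤ length P ×
    Σ (List (Vtx G)) λ X → Σ (List (Vtx G)) λ Y → P ≡ X ++ Y ×
    ((length X ≡ k) ⊎ (length Y ≡ k)) × ReplaceBy 𝒫 P (X ∷ Y ∷ []) 𝒫'

  BreakAll : Coll G → Coll G → Set
  BreakAll 𝒫 𝒫' = Star Break1 𝒫 𝒫' × All (λ P → length P < 2 * k) 𝒫'

  -- one iteration of the while loop
  Step : Coll G → Coll G → Set
  Step 𝒫 𝒫'' = Σ (Coll G) λ 𝒫' → Op 𝒫 𝒫' × BreakAll 𝒫' 𝒫''

  -- 𝒫 is a possible output of Approx1 on G
  Returned : Coll G → Set
  Returned 𝒫 = Star Step [] 𝒫 × (∀ 𝒫' → ¬ Op 𝒫 𝒫')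

-- If either bound failed, the two vertex-disjoint extensions e(u_t) and e(u_j)
-- (resp. e(v_j)) would make DoubleRep (i) (resp. (ii)) applicable to P,
-- contradicting termination of Approx1. For (i), a vertex u_j has
-- j < ⌈ℓ/2⌉, hence ℓ - j ≥ j + 1, so the threshold k - (ℓ - j) of DoubleRep is
-- at most k - j - 1; the bound j ≤ k - 2 is the case of the empty extension.
module Submission where

open import Defs
open import Data.Nat using (ℕ; zero; suc; _+_; _∸_; _≤_; _<_; z≤n; s≤s; ⌈_/2⌉)
open import Data.Nat.Properties
open import Data.List using (List; []; _++_; length)
open import Data.List.Membership.Propositional using (_∈_)
open import Data.List.Membership.Propositional.Properties using (∈-∃++)
open import Data.List.Relation.Unary.All using ([]; tabulate)
open import Data.List.Relation.Unary.AllPairs using ([])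
open import Data.List.Relation.Unary.Linked using ([])
open import Data.Product using (_×_; _,_; ∃; proj₁; proj₂)
open import Data.Sum using (inj₁; inj₂)
open import Data.Unit using (tt)
open import Relation.Nullary using (¬_)
open import Relation.Binary.PropositionalEquality using (refl; cong)

<⌈/2⌉⇒≤∸ : ∀ {j ℓ} → j < ⌈ ℓ /2⌉ → suc j ≤ ℓ ∸ j
<⌈/2⌉⇒≤∸ {j} {ℓ} j<⌈ℓ/2⌉ = m+n≤o⇒m≤o∸n (suc j) (twice+1≤ j ℓ j<⌈ℓ/2⌉)
  where
  twice+1≤ : ∀ j ℓ → j < ⌈ ℓ /2⌉ → suc (j + j) ≤ ℓ
  twice+1≤ zero    (suc ℓ)       _         = s≤s z≤n
  twice+1≤ (suc j) (suc (suc ℓ)) (s≤s j<) rewrite +-suc j j = s≤s (s≤s (twice+1≤ j ℓ j<))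

≰+1⇒+2≤ : ∀ {m k} → ¬ k ≤ m + 1 → m + 2 ≤ k
≰+1⇒+2≤ {m} k≰ rewrite +-suc m 1 = ≰⇒> k≰

replaceBy-∈ : ∀ {A : Set} {𝒫 : List (List A)} {P} → P ∈ 𝒫 →
              (R : List (List A)) → ∃ (ReplaceBy 𝒫 P R)
replaceBy-∈ P∈𝒫 R with ∈-∃++ P∈𝒫
... | L , B , refl = L ++ R ++ B , L , B , refl , refl

empty-Ext : ∀ {G 𝒫 y} → Ext G 𝒫 y []
empty-Ext = ([] , []) , [] , tt

lemma5 : (k : ℕ) → 4 ≤ k → (G : Graph) → (𝒫 : Coll G) → Returned G k 𝒫 →
    (P : List (Vtx G)) → P ∈ 𝒫 → (Q : List (Vtx G)) → Orient P Q →
    (t : ℕ) (x : Vtx G) → UVert Q t x →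
    (e : List (Vtx G)) → Ext G 𝒫 x e → k ≤ length e + t + 1 →
      ((j : ℕ) (y : Vtx G) → t < j → UVert Q j y →
          (j + 2 ≤ k)
          × ((f : List (Vtx G)) → Ext G 𝒫 y f → Disjoint e f → length f + j + 2 ≤ k))
      × ((j : ℕ) (y : Vtx G) → VVert Q j y →
          (f : List (Vtx G)) → Ext G 𝒫 y f → Disjoint e f → length f + j + 2 ≤ k)
lemma5 k _ G 𝒫 (_ , stuck) P P∈𝒫 Q PQ t x ut e ext-e long-e =
  (λ j y t<j uj → index-bound j y t<j uj , bound-u j y t<j uj) , bound-v
  where
  bound-u : ∀ j y → t < j → UVert Q j y →
            (f : List (Vtx G)) → Ext G 𝒫 y f → Disjoint e f → length f + j + 2 ≤ k
  bound-u j y t<j uj f ext-f e#f = ≰+1⇒+2≤ λ k≤f+j+1 →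
    stuck _ (inj₂ (inj₂ (P , Q , PQ , t , x , e , ut , ext-e , long-e , j , y , f , ext-f , e#f ,
      inj₁ (t<j , uj , ≤-trans k≤f+j+1 f+j+1≤f+ℓ-j , proj₂ (replaceBy-∈ P∈𝒫 _)))))
    where
    open ≤-Reasoning
    f+j+1≤f+ℓ-j : length f + j + 1 ≤ length f + (length Q ∸ j)
    f+j+1≤f+ℓ-j = begin
      length f + j + 1         ≡⟨ +-assoc (length f) j 1 ⟩
      length f + (j + 1)       ≡⟨ cong (length f +_) (+-comm j 1) ⟩
      length f + suc j         ≤⟨ +-monoʳ-≤ (length f) (<⌈/2⌉⇒≤∸ (proj₁ uj)) ⟩
      length f + (length Q ∸ j) ∎

  index-bound : ∀ j y → t < j → UVert Q j y → j + 2 ≤ k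
  index-bound j y t<j uj = bound-u j y t<j uj [] (empty-Ext {G} {𝒫} {y}) (tabulate λ _ ())

  bound-v : (j : ℕ) (y : Vtx G) → VVert Q j y →
            (f : List (Vtx G)) → Ext G 𝒫 y f → Disjoint e f → length f + j + 2 ≤ k
  bound-v j y vj f ext-f e#f = ≰+1⇒+2≤ λ k≤f+j+1 →
    stuck _ (inj₂ (inj₂ (P , Q , PQ , t , x , e , ut , ext-e , long-e , j , y , f , ext-f , e#f ,
      inj₂ (vj , k≤f+j+1 , proj₂ (replaceBy-∈ P∈𝒫 _)))))
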